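{- For positive integers $n,p$, let $\mathcal{A}^p_n=\{S\subset\{1,\ldots,n\}: \min S\geqslant |S|^p \text{ and } n\in S\}$ and $\mathcal{B}^p_n=\{S\subset\{1,\ldots,n\}: S=\emptyset \text{ or } (\max S-1\in S \text{ and } \min S\geqslant |S|^p)\}$. Then $|\mathcal{A}^p_n|=|\mathcal{B}^p_n|$ for all $n,p\in\mathbb{N}$.
   Context: $\mathbb{N}=\{1,2,\ldots\}$. -}

module Defs where

open import Data.Nat using (ℕ; zero; suc; _+_; _^_; _≤_; _≤?_)
open import Data.Nat.Properties using (_≟_)
open import Data.Fin using (Fin; toℕ)
open import Data.Fin.Properties using (any?; all?)
open import Data.Fin.Subset using (Subset; _∈_; _∉_; ∣_∣; Empty; Nonempty)
open import Data.Fin.Subset.Properties using (_∈?_)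
open import Data.Vec using (Vec; []; _∷_)
open import Data.Bool using (Bool; true; false)
open import Data.List using (List; []; _∷_; map; _++_; length; filter)
open import Data.Product using (Σ; ∃; _×_; _,_)
open import Data.Sum using (_⊎_)
open import Relation.Binary.PropositionalEquality using (_≡_)
open import Relation.Nullary using (Dec; ¬_)
open import Relation.Nullary.Decidable using (_×-dec_; _⊎-dec_; _→-dec_; ¬?)
import Agda.Primitive
open import Relation.Unary using (Pred; Decidable)

-- A subset S of {1,…,n} is encoded as  S : Subset n  (a Vec Bool n);
-- the index  i : Fin n  stands for the integer  val i = toℕ i + 1.
val : ∀ {n} → Fin n → ℕ
val i = suc (toℕ i)

_∈ℕ_ : ∀ {n} → ℕ → Subset n → Set
m ∈ℕ S = ∃ λ i → i ∈ S × val i ≡ m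

MinGeq : ∀ {n} → Subset n → ℕ → Set
MinGeq S k = ∀ i → i ∈ S → k ≤ val i

-- "max S - 1 ∈ S"  (S nonempty): the largest element m of S satisfies
-- that m - 1 (which must be a positive integer to lie in S) is in S
MaxPredIn : ∀ {n} → Subset n → Set
MaxPredIn S = ∃ λ i → i ∈ S × (∀ j → j ∈ S → val j ≤ val i)
                    × (∃ λ j → j ∈ S × val j + 1 ≡ val i)

InA : ℕ → (n : ℕ) → Subset n → Set
InA p n S = MinGeq S (∣ S ∣ ^ p) × n ∈ℕ S

InB : ℕ → (n : ℕ) → Subset n → Set
InB p n S = Empty S ⊎ (MaxPredIn S × MinGeq S (∣ S ∣ ^ p))

∈ℕ? : ∀ {n} (m : ℕ) (S : Subset n) → Dec (m ∈ℕ S)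
∈ℕ? m S = any? (λ i → (i ∈? S) ×-dec (val i ≟ m))

MinGeq? : ∀ {n} (S : Subset n) (k : ℕ) → Dec (MinGeq S k)
MinGeq? S k = all? (λ i → (i ∈? S) →-dec (k ≤? val i))

MaxPredIn? : ∀ {n} (S : Subset n) → Dec (MaxPredIn S)
MaxPredIn? S = any? (λ i → (i ∈? S) ×-dec
  (all? (λ j → (j ∈? S) →-dec (val j ≤? val i)) ×-dec
   any? (λ j → (j ∈? S) ×-dec (val j + 1 ≟ val i))))

Empty? : ∀ {n} (S : Subset n) → Dec (Empty S)
Empty? S = ¬? (any? (λ i → i ∈? S))

InA? : ∀ p n → Decidable (InA p n)
InA? p n S = MinGeq? S (∣ S ∣ ^ p) ×-dec ∈ℕ? n S

InB? : ∀ p n → Decidable (InB p n)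
InB? p n S = Empty? S ⊎-dec (MaxPredIn? S ×-dec MinGeq? S (∣ S ∣ ^ p))

allSubsets : ∀ n → List (Subset n)
allSubsets zero    = [] ∷ []
allSubsets (suc n) = map (false ∷_) (allSubsets n) ++ map (true ∷_) (allSubsets n)

count : ∀ n {P : Pred (Subset n) Agda.Primitive.lzero} → Decidable P → ℕ
count n P? = length (filter P? (allSubsets n))

cardA : ℕ → ℕ → ℕ
cardA n p = count n (InA? p n)

cardB : ℕ → ℕ → ℕ
cardB n p = count n (InB? p n)

-- The sets of 𝒜ⁿₚ other than {n} are w ∪ {n}, and those of ℬⁿₚ other than ∅ are w ∪ {max w + 1},
-- for w ranging over the nonempty subsets of {1,…,n−1}.  Both have the size and the minimum of
-- w ∪ {n}, so the condition min S ≥ |S|ᵖ selects the same w on either side.  (The argument does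
-- not use p ≥ 1.)
module Submission where

open import Defs
open import Level using (0ℓ)
open import Data.Nat using (ℕ; zero; suc; pred; _+_; _^_; _≤_; z≤n; s≤s)
open import Data.Nat.Properties using (+-suc; +-commutativeSemigroup; ^-zeroˡ; pred-mono-≤; ≤-pred; ≤-refl; ≤-trans; suc-injective)
open import Algebra.Properties.CommutativeSemigroup +-commutativeSemigroup using (interchange)
open import Data.Fin using (zero; suc)
open import Data.Fin.Subset using (Subset; ⊥; _∈_; ∣_∣; Empty; Nonempty)
open import Data.Fin.Subset.Properties using (Empty-unique; ∉⊥; ∣⊥∣≡0; nonempty?)
open import Data.Vec using ([]; _∷_; _∷ʳ_; here; there)
open import Data.Vec.Properties using (∷-injective)
open import Data.Bool using (Bool; true; false; if_then_else_)
open import Data.List using (List; []; _∷_; map; _++_; length; filter)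
open import Data.List.Properties using (length-++; filter-++; filter-≐; filter-none; filter-accept)
open import Data.List.Relation.Unary.All using (universal)
open import Data.Product using (_×_; _,_; proj₁; proj₂)
open import Data.Sum using (_⊎_; inj₁; inj₂; [_,_]′)
open import Function using (_∘_; id)
open import Function.Bundles using (_⇔_; mk⇔; Equivalence)
open import Function.Construct.Composition using (_⇔-∘_)
open import Function.Construct.Symmetry using (⇔-sym)
open import Function.Construct.Identity using (⇔-id)
open import Data.Product.Function.NonDependent.Propositional using (_×-⇔_)
open import Relation.Binary.PropositionalEquality using (_≡_; _≢_; refl; sym; trans; cong; cong₂; subst; module ≡-Reasoning)
open import Relation.Nullary using (¬_; Dec; yes; no; does; contradiction)
open import Relation.Unary using (Pred; Decidable)
open import Relation.Unary.Properties using (_∩?_; ∁?)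

open Equivalence using (to; from)
open ≡-Reasoning

private variable
  m : ℕ

length-filter-map : ∀ {A B : Set} {P : Pred B 0ℓ} (P? : Decidable P) (f : A → B) (xs : List A) →
                    length (filter P? (map f xs)) ≡ length (filter (λ x → P? (f x)) xs)
length-filter-map P? f [] = refl
length-filter-map P? f (x ∷ xs) with does (P? (f x))
... | true  = cong suc (length-filter-map P? f xs)
... | false = length-filter-map P? f xs

length-filter-partition : ∀ {A : Set} {P Q : Pred A 0ℓ} (Q? : Decidable Q) (P? : Decidable P) (xs : List A) →
  length (filter P? xs) ≡ length (filter (Q? ∩? P?) xs) + length (filter (∁? Q? ∩? P?) xs)
length-filter-partition Q? P? [] = refl
length-filter-partition Q? P? (x ∷ xs) with ih ← length-filter-partition Q? P? xs | Q? x | P? x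
... | yes _ | yes _ = cong suc ih
... | no _  | yes _ = trans (cong suc ih) (sym (+-suc _ _))
... | yes _ | no _  = ih
... | no _  | no _  = ih

module _ (n : ℕ) {P : Pred (Subset n) 0ℓ} (P? : Decidable P) where

  count-cong : ∀ {Q} (Q? : Decidable Q) → (∀ S → P S ⇔ Q S) → count n P? ≡ count n Q?
  count-cong Q? P⇔Q = cong length (filter-≐ P? Q? ((λ {S} → to (P⇔Q S)) , (λ {S} → from (P⇔Q S))) (allSubsets n))

  count-partition : ∀ {Q} (Q? : Decidable Q) → count n P? ≡ count n (Q? ∩? P?) + count n (∁? Q? ∩? P?)
  count-partition Q? = length-filter-partition Q? P? (allSubsets n)

  count-none : (∀ S → ¬ P S) → count n P? ≡ 0
  count-none ¬P = cong length (filter-none P? (universal ¬P (allSubsets n)))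

count-∷ : ∀ n {P : Pred (Subset (suc n)) 0ℓ} (P? : Decidable P) →
          count (suc n) P? ≡ count n (λ S → P? (false ∷ S)) + count n (λ S → P? (true ∷ S))
count-∷ n P? = begin
  length (filter P? (map (false ∷_) subsets ++ map (true ∷_) subsets))
    ≡⟨ cong length (filter-++ P? (map (false ∷_) subsets) _) ⟩
  length (filter P? (map (false ∷_) subsets) ++ filter P? (map (true ∷_) subsets))
    ≡⟨ length-++ (filter P? (map (false ∷_) subsets)) ⟩
  length (filter P? (map (false ∷_) subsets)) + length (filter P? (map (true ∷_) subsets))
    ≡⟨ cong₂ _+_ (length-filter-map P? (false ∷_) subsets) (length-filter-map P? (true ∷_) subsets) ⟩
  count n (λ S → P? (false ∷ S)) + count n (λ S → P? (true ∷ S)) ∎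
  where subsets = allSubsets n

count-∷ʳ : ∀ n {P : Pred (Subset (suc n)) 0ℓ} (P? : Decidable P) →
           count (suc n) P? ≡ count n (λ w → P? (w ∷ʳ false)) + count n (λ w → P? (w ∷ʳ true))
count-∷ʳ zero    P? = trans (count-∷ zero P?) (cong₂ _+_ (base false) (base true))
  where
  base : ∀ b → count 0 (λ S → P? (b ∷ S)) ≡ count 0 (λ w → P? (w ∷ʳ b))
  base b = count-cong 0 (λ S → P? (b ∷ S)) (λ w → P? (w ∷ʳ b)) λ { [] → ⇔-id _ }
count-∷ʳ (suc n) P? = begin
  count (suc (suc n)) P?
    ≡⟨ count-∷ (suc n) P? ⟩
  count (suc n) (λ S → P? (false ∷ S)) + count (suc n) (λ S → P? (true ∷ S))
    ≡⟨ cong₂ _+_ (count-∷ʳ n (λ S → P? (false ∷ S))) (count-∷ʳ n (λ S → P? (true ∷ S))) ⟩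
  (c false false + c false true) + (c true false + c true true)
    ≡⟨ interchange (c false false) (c false true) (c true false) (c true true) ⟩
  (c false false + c true false) + (c false true + c true true)
    ≡⟨ sym (cong₂ _+_ (count-∷ n (λ w → P? (w ∷ʳ false))) (count-∷ n (λ w → P? (w ∷ʳ true)))) ⟩
  count (suc n) (λ w → P? (w ∷ʳ false)) + count (suc n) (λ w → P? (w ∷ʳ true)) ∎
  where
  c : Bool → Bool → ℕ
  c b b′ = count n (λ w → P? (b ∷ (w ∷ʳ b′)))

module _ {n} {P : Pred (Subset (suc n)) 0ℓ} {b} {S₀ : Subset n} (P⇔ : ∀ S → P S ⇔ S ≡ b ∷ S₀) where

  unique-tail : ∀ S → P (b ∷ S) ⇔ S ≡ S₀
  unique-tail S = mk⇔ (proj₂ ∘ ∷-injective) (cong (b ∷_)) ⇔-∘ P⇔ (b ∷ S)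

  unique-other-head : ∀ {c} → c ≢ b → ∀ S → ¬ P (c ∷ S)
  unique-other-head c≢b S = c≢b ∘ proj₁ ∘ ∷-injective ∘ to (P⇔ _)

count-unique : ∀ n {P : Pred (Subset n) 0ℓ} (P? : Decidable P) (S₀ : Subset n) →
               (∀ S → P S ⇔ S ≡ S₀) → count n P? ≡ 1
count-unique zero P? [] P⇔ = cong length (filter-accept P? (from (P⇔ []) refl))
count-unique (suc n) P? (false ∷ S₀) P⇔ = trans (count-∷ n P?) (cong₂ _+_
  (count-unique n (λ S → P? (false ∷ S)) S₀ (unique-tail P⇔))
  (count-none n (λ S → P? (true ∷ S)) (unique-other-head P⇔ λ ())))
count-unique (suc n) P? (true ∷ S₀) P⇔ = trans (count-∷ n P?) (cong₂ _+_
  (count-none n (λ S → P? (false ∷ S)) (unique-other-head P⇔ λ ()))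
  (count-unique n (λ S → P? (true ∷ S)) S₀ (unique-tail P⇔)))

count-singleton : ∀ n {P : Pred (Subset n) 0ℓ} (P? : Decidable P) {A : Set} (A? : Dec A) (S₀ : Subset n) →
                  (∀ S → P S ⇔ (S ≡ S₀ × A)) → count n P? ≡ (if does A? then 1 else 0)
count-singleton n P? (yes a) S₀ P⇔ =
  count-unique n P? S₀ λ S → mk⇔ (proj₁ ∘ to (P⇔ S)) (λ S≡S₀ → from (P⇔ S) (S≡S₀ , a))
count-singleton n P? (no ¬a) S₀ P⇔ = count-none n P? λ S → ¬a ∘ proj₂ ∘ to (P⇔ S)

Empty-⊥ : ∀ {n} → Empty (⊥ {n})
Empty-⊥ (_ , i∈⊥) = ∉⊥ i∈⊥

Nonempty-false∷ : (S : Subset m) → Nonempty (false ∷ S) ⇔ Nonempty S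
Nonempty-false∷ S = mk⇔ (λ { (suc i , there i∈S) → i , i∈S }) (λ (i , i∈S) → suc i , there i∈S)

top∈-∷ʳ-true : (w : Subset m) → suc m ∈ℕ (w ∷ʳ true)
top∈-∷ʳ-true []      = zero , here , refl
top∈-∷ʳ-true (_ ∷ w) with i , i∈ , e ← top∈-∷ʳ-true w = suc i , there i∈ , cong suc e

top∉-∷ʳ-false : (w : Subset m) → ¬ suc m ∈ℕ (w ∷ʳ false)
top∉-∷ʳ-false []      (zero , () , _)
top∉-∷ʳ-false (_ ∷ w) (zero , _ , ())
top∉-∷ʳ-false (_ ∷ w) (suc i , there i∈ , e) = top∉-∷ʳ-false w (i , i∈ , suc-injective e)

∣w∷ʳtrue∣≡1+∣w∣ : (w : Subset m) → ∣ w ∷ʳ true ∣ ≡ suc ∣ w ∣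
∣w∷ʳtrue∣≡1+∣w∣ []          = refl
∣w∷ʳtrue∣≡1+∣w∣ (false ∷ w) = ∣w∷ʳtrue∣≡1+∣w∣ w
∣w∷ʳtrue∣≡1+∣w∣ (true ∷ w)  = cong suc (∣w∷ʳtrue∣≡1+∣w∣ w)

MinGeq-1 : (S : Subset m) → MinGeq S 1
MinGeq-1 S _ _ = s≤s z≤n

MinGeq-false∷ : (S : Subset m) (k : ℕ) → MinGeq (false ∷ S) k ⇔ MinGeq S (pred k)
MinGeq-false∷ S k = mk⇔ (λ h i i∈S → pred-mono-≤ (h (suc i) (there i∈S)))
                        (λ { h (suc i) (there i∈S) → pred≤⇒≤suc k (h i i∈S) })
  where
  pred≤⇒≤suc : ∀ k {x} → pred k ≤ x → k ≤ suc x
  pred≤⇒≤suc zero    _ = z≤n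
  pred≤⇒≤suc (suc k)   = s≤s

MinGeq-true∷ : (S : Subset m) (k : ℕ) → MinGeq (true ∷ S) k ⇔ k ≤ 1
MinGeq-true∷ S k = mk⇔ (λ h → h zero here) (λ k≤1 i _ → ≤-trans k≤1 (s≤s z≤n))

-- w ∪ {max w + 1}.  For empty w it is {m + 1}, so that for every w it has the same size and
-- minimum as w ∪ {m + 1}.
insertAboveMax : Subset m → Subset (suc m)
insertAboveMax []          = true ∷ []
insertAboveMax (false ∷ w) = false ∷ insertAboveMax w
insertAboveMax (true ∷ w)  = true ∷ (if does (nonempty? w) then insertAboveMax w else true ∷ w)

insertAboveMax-true∷-nonempty : {w : Subset m} → Nonempty w → insertAboveMax (true ∷ w) ≡ true ∷ insertAboveMax w
insertAboveMax-true∷-nonempty {w = w} ne with nonempty? w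
... | yes _  = refl
... | no ¬ne = contradiction ne ¬ne

insertAboveMax-true∷⊥ : insertAboveMax (true ∷ ⊥ {m}) ≡ true ∷ true ∷ ⊥
insertAboveMax-true∷⊥ {m} with nonempty? (⊥ {m})
... | yes ne = contradiction ne Empty-⊥
... | no _   = refl

∣insertAboveMax[w]∣≡1+∣w∣ : (w : Subset m) → ∣ insertAboveMax w ∣ ≡ suc ∣ w ∣
∣insertAboveMax[w]∣≡1+∣w∣ []          = refl
∣insertAboveMax[w]∣≡1+∣w∣ (false ∷ w) = ∣insertAboveMax[w]∣≡1+∣w∣ w
∣insertAboveMax[w]∣≡1+∣w∣ (true ∷ w) with nonempty? w
... | yes _ = cong suc (∣insertAboveMax[w]∣≡1+∣w∣ w)
... | no _  = refl

MinGeq-insertAboveMax : (w : Subset m) (k : ℕ) → MinGeq (insertAboveMax w) k ⇔ MinGeq (w ∷ʳ true) k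
MinGeq-insertAboveMax []          k = ⇔-id _
MinGeq-insertAboveMax (false ∷ w) k =
  ⇔-sym (MinGeq-false∷ (w ∷ʳ true) k) ⇔-∘ (MinGeq-insertAboveMax w (pred k) ⇔-∘ MinGeq-false∷ (insertAboveMax w) k)
MinGeq-insertAboveMax (true ∷ w)  k = ⇔-sym (MinGeq-true∷ (w ∷ʳ true) k) ⇔-∘ MinGeq-true∷ _ k

MaxPredIn-∷ : ∀ {n} b {S : Subset n} → MaxPredIn S → MaxPredIn (b ∷ S)
MaxPredIn-∷ b (i , i∈ , max , j , j∈ , j+1≡i) = suc i , there i∈ , max′ , suc j , there j∈ , cong suc j+1≡i
  where
  max′ : ∀ k → k ∈ b ∷ _ → val k ≤ val (suc i)
  max′ zero    _          = s≤s z≤n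
  max′ (suc k) (there k∈) = s≤s (max k k∈)

MaxPredIn-∷⁻ : ∀ {n b} {S : Subset (suc n)} → MaxPredIn (b ∷ S) → MaxPredIn S ⊎ b ∷ S ≡ true ∷ true ∷ ⊥
MaxPredIn-∷⁻ (zero        , _ , _ , zero  , _ , ())
MaxPredIn-∷⁻ (zero        , _ , _ , suc _ , _ , ())
MaxPredIn-∷⁻ (suc (suc _) , _ , _ , zero  , _ , ())
MaxPredIn-∷⁻ (suc i , there i∈ , max , suc j , there j∈ , j+1≡i) =
  inj₁ (i , i∈ , (λ k k∈ → ≤-pred (max (suc k) (there k∈))) , j , j∈ , suc-injective j+1≡i)
MaxPredIn-∷⁻ {S = true ∷ S} (suc zero , there here , max , zero , here , refl) =
  inj₂ (cong (λ S → true ∷ true ∷ S) (Empty-unique nothing-above-2))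
  where
  nothing-above-2 : Empty S
  nothing-above-2 (k , k∈) with max (suc (suc k)) (there (there k∈))
  ... | s≤s (s≤s ())

¬MaxPredIn-singleton : ∀ {n} b → ¬ MaxPredIn (b ∷ ⊥ {n})
¬MaxPredIn-singleton b (zero  , _ , _ , zero  , _ , ())
¬MaxPredIn-singleton b (zero  , _ , _ , suc _ , _ , ())
¬MaxPredIn-singleton b (suc _ , there i∈⊥ , _) = ∉⊥ i∈⊥

MaxPredIn-pair : ∀ {n} → MaxPredIn (true ∷ true ∷ ⊥ {n})
MaxPredIn-pair = suc zero , there here , max , zero , here , refl
  where
  max : ∀ k → k ∈ true ∷ true ∷ ⊥ → val k ≤ 2
  max zero                _                    = s≤s z≤n
  max (suc zero)          _                    = ≤-refl
  max (suc (suc _)) (there (there k∈⊥)) = contradiction k∈⊥ ∉⊥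

MaxPredIn-false∷ : (S : Subset (suc m)) → MaxPredIn (false ∷ S) ⇔ MaxPredIn S
MaxPredIn-false∷ S = mk⇔ (λ mp → [ id , (λ ()) ]′ (MaxPredIn-∷⁻ mp)) (MaxPredIn-∷ false)

MaxPredIn⇒Nonempty : {S : Subset m} → MaxPredIn S → Nonempty S
MaxPredIn⇒Nonempty (i , i∈ , _) = i , i∈

count-MaxPredIn : ∀ m {G : Pred (Subset (suc m)) 0ℓ} (G? : Decidable G) →
                  count (suc m) (MaxPredIn? ∩? G?) ≡ count m (nonempty? ∩? (G? ∘ insertAboveMax))
count-MaxPredIn zero G? = trans
  (count-none 1 (MaxPredIn? ∩? G?) λ { (b ∷ []) → ¬MaxPredIn-singleton b ∘ proj₁ })
  (sym (count-none 0 (nonempty? ∩? (G? ∘ insertAboveMax)) λ { [] ((() , _) , _) }))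
count-MaxPredIn (suc m) {G} G? = begin
  count (suc (suc m)) L                           ≡⟨ count-∷ (suc m) L ⟩
  count (suc m) (L ∘ (false ∷_)) + count (suc m) (L ∘ (true ∷_)) ≡⟨ cong₂ _+_ head-false head-true ⟩
  count m (R ∘ (false ∷_)) + count m (R ∘ (true ∷_))             ≡⟨ count-∷ m R ⟨
  count (suc m) R                                 ∎
  where
  L = MaxPredIn? ∩? G?
  R = nonempty? ∩? (G? ∘ insertAboveMax)

  head-false : count (suc m) (L ∘ (false ∷_)) ≡ count m (R ∘ (false ∷_))
  head-false = begin
    count (suc m) (L ∘ (false ∷_))
      ≡⟨ count-cong (suc m) _ (MaxPredIn? ∩? (G? ∘ (false ∷_))) (λ S → MaxPredIn-false∷ S ×-⇔ ⇔-id _) ⟩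
    count (suc m) (MaxPredIn? ∩? (G? ∘ (false ∷_)))
      ≡⟨ count-MaxPredIn m (G? ∘ (false ∷_)) ⟩
    count m (nonempty? ∩? (G? ∘ (false ∷_) ∘ insertAboveMax))
      ≡⟨ count-cong m _ (R ∘ (false ∷_)) (λ w → ⇔-sym (Nonempty-false∷ w) ×-⇔ ⇔-id _) ⟩
    count m (R ∘ (false ∷_)) ∎

  pair = true ∷ true ∷ ⊥
  [G-pair] = if does (G? pair) then 1 else 0

  head-true : count (suc m) (L ∘ (true ∷_)) ≡ count m (R ∘ (true ∷_))
  head-true = begin
    count (suc m) (L ∘ (true ∷_))
      ≡⟨ count-partition (suc m) (L ∘ (true ∷_)) MaxPredIn? ⟩
    count (suc m) (MaxPredIn? ∩? (L ∘ (true ∷_))) + count (suc m) (∁? MaxPredIn? ∩? (L ∘ (true ∷_)))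
      ≡⟨ cong₂ _+_ (count-cong (suc m) _ (MaxPredIn? ∩? (G? ∘ (true ∷_))) MaxPredIn-case)
                   (count-singleton (suc m) _ (G? pair) (true ∷ ⊥) ¬MaxPredIn-case) ⟩
    count (suc m) (MaxPredIn? ∩? (G? ∘ (true ∷_))) + [G-pair]
      ≡⟨ cong (_+ [G-pair]) (count-MaxPredIn m (G? ∘ (true ∷_))) ⟩
    count m (nonempty? ∩? (G? ∘ (true ∷_) ∘ insertAboveMax)) + [G-pair]
      ≡⟨ cong₂ _+_ (count-cong m _ _ Nonempty-case) (count-singleton m _ (G? pair) ⊥ Empty-case) ⟨
    count m (nonempty? ∩? (R ∘ (true ∷_))) + count m (∁? nonempty? ∩? (R ∘ (true ∷_)))
      ≡⟨ count-partition m (R ∘ (true ∷_)) nonempty? ⟨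
    count m (R ∘ (true ∷_)) ∎
    where
    MaxPredIn-case : ∀ S → (MaxPredIn S × MaxPredIn (true ∷ S) × G (true ∷ S)) ⇔ (MaxPredIn S × G (true ∷ S))
    MaxPredIn-case S = mk⇔ (λ (mp , _ , g) → mp , g) (λ (mp , g) → mp , MaxPredIn-∷ true mp , g)

    ¬MaxPredIn-case : ∀ S → (¬ MaxPredIn S × MaxPredIn (true ∷ S) × G (true ∷ S)) ⇔ (S ≡ true ∷ ⊥ × G pair)
    ¬MaxPredIn-case S = mk⇔ to′ λ { (refl , g) → ¬MaxPredIn-singleton true , MaxPredIn-pair , g }
      where
      to′ : ¬ MaxPredIn S × MaxPredIn (true ∷ S) × G (true ∷ S) → S ≡ true ∷ ⊥ × G pair
      to′ (¬mp , mp , g) with MaxPredIn-∷⁻ mp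
      ... | inj₁ mp′  = contradiction mp′ ¬mp
      ... | inj₂ refl = refl , g

    Nonempty-case : ∀ w → (Nonempty w × Nonempty (true ∷ w) × G (insertAboveMax (true ∷ w)))
                          ⇔ (Nonempty w × G (true ∷ insertAboveMax w))
    Nonempty-case w = mk⇔
      (λ (ne , _ , g) → ne , subst G (insertAboveMax-true∷-nonempty ne) g)
      (λ (ne , g) → ne , (zero , here) , subst G (sym (insertAboveMax-true∷-nonempty ne)) g)

    Empty-case : ∀ w → (Empty w × Nonempty (true ∷ w) × G (insertAboveMax (true ∷ w))) ⇔ (w ≡ ⊥ × G pair)
    Empty-case w = mk⇔ to′ λ { (refl , g) → Empty-⊥ , (zero , here) , subst G (sym insertAboveMax-true∷⊥) g }
      where
      to′ : Empty w × Nonempty (true ∷ w) × G (insertAboveMax (true ∷ w)) → w ≡ ⊥ × G pair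
      to′ (¬ne , _ , g) with refl ← Empty-unique ¬ne = refl , subst G insertAboveMax-true∷⊥ g

MinGeqSizePow : ℕ → Subset m → Set
MinGeqSizePow p S = MinGeq S (∣ S ∣ ^ p)

MinGeqSizePow? : ∀ p → Decidable (MinGeqSizePow {m} p)
MinGeqSizePow? p S = MinGeq? S (∣ S ∣ ^ p)

MinGeqSizePow-insertAboveMax : ∀ p (w : Subset m) →
                               MinGeqSizePow p (insertAboveMax w) ⇔ MinGeqSizePow p (w ∷ʳ true)
MinGeqSizePow-insertAboveMax p w rewrite ∣insertAboveMax[w]∣≡1+∣w∣ w | ∣w∷ʳtrue∣≡1+∣w∣ w =
  MinGeq-insertAboveMax w (suc ∣ w ∣ ^ p)

MinGeqSizePow-singleton : ∀ p → MinGeqSizePow p (⊥ {m} ∷ʳ true)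
MinGeqSizePow-singleton {m} p rewrite ∣w∷ʳtrue∣≡1+∣w∣ (⊥ {m}) | ∣⊥∣≡0 m | ^-zeroˡ p = MinGeq-1 _

cardA-suc : ∀ m p → cardA (suc m) p ≡ count m (nonempty? ∩? (MinGeqSizePow? p ∘ insertAboveMax)) + 1
cardA-suc m p = begin
  count (suc m) (InA? p (suc m))
    ≡⟨ count-∷ʳ m (InA? p (suc m)) ⟩
  count m (λ w → InA? p (suc m) (w ∷ʳ false)) + count m A⁺
    ≡⟨ cong (_+ count m A⁺) (count-none m (λ w → InA? p (suc m) (w ∷ʳ false)) (λ w → top∉-∷ʳ-false w ∘ proj₂)) ⟩
  count m A⁺
    ≡⟨ count-partition m A⁺ nonempty? ⟩
  count m (nonempty? ∩? A⁺) + count m (∁? nonempty? ∩? A⁺)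
    ≡⟨ cong₂ _+_ (count-cong m _ _ Nonempty-case) (count-unique m _ ⊥ Empty-case) ⟩
  count m (nonempty? ∩? (MinGeqSizePow? p ∘ insertAboveMax)) + 1 ∎
  where
  A⁺ = λ w → InA? p (suc m) (w ∷ʳ true)

  Nonempty-case : ∀ w → (Nonempty w × InA p (suc m) (w ∷ʳ true)) ⇔ (Nonempty w × MinGeqSizePow p (insertAboveMax w))
  Nonempty-case w = mk⇔
    (λ (ne , g , _) → ne , from (MinGeqSizePow-insertAboveMax p w) g)
    (λ (ne , g) → ne , to (MinGeqSizePow-insertAboveMax p w) g , top∈-∷ʳ-true w)

  Empty-case : ∀ w → (Empty w × InA p (suc m) (w ∷ʳ true)) ⇔ w ≡ ⊥
  Empty-case w = mk⇔ (Empty-unique ∘ proj₁)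
    λ { refl → Empty-⊥ , MinGeqSizePow-singleton p , top∈-∷ʳ-true ⊥ }

cardB-suc : ∀ m p → cardB (suc m) p ≡ count (suc m) (MaxPredIn? ∩? MinGeqSizePow? p) + 1
cardB-suc m p = begin
  count (suc m) (InB? p (suc m))
    ≡⟨ count-partition (suc m) (InB? p (suc m)) nonempty? ⟩
  count (suc m) (nonempty? ∩? InB? p (suc m)) + count (suc m) (∁? nonempty? ∩? InB? p (suc m))
    ≡⟨ cong₂ _+_ (count-cong (suc m) _ _ Nonempty-case) (count-unique (suc m) _ ⊥ Empty-case) ⟩
  count (suc m) (MaxPredIn? ∩? MinGeqSizePow? p) + 1 ∎
  where
  Nonempty-case : ∀ S → (Nonempty S × InB p (suc m) S) ⇔ (MaxPredIn S × MinGeqSizePow p S)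
  Nonempty-case S = mk⇔ (λ { (ne , inj₁ empty) → contradiction ne empty ; (_ , inj₂ mp,g) → mp,g })
                        (λ (mp , g) → MaxPredIn⇒Nonempty mp , inj₂ (mp , g))

  Empty-case : ∀ S → (Empty S × InB p (suc m) S) ⇔ S ≡ ⊥
  Empty-case S = mk⇔ (Empty-unique ∘ proj₁) λ { refl → Empty-⊥ , inj₁ Empty-⊥ }

theorem5 : (n p : ℕ) → 1 ≤ n → 1 ≤ p → cardA n p ≡ cardB n p
theorem5 zero    p () _
theorem5 (suc m) p _  _ = begin
  cardA (suc m) p                                                    ≡⟨ cardA-suc m p ⟩
  count m (nonempty? ∩? (MinGeqSizePow? p ∘ insertAboveMax)) + 1  ≡⟨ cong (_+ 1) (count-MaxPredIn m (MinGeqSizePow? p)) ⟨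
  count (suc m) (MaxPredIn? ∩? MinGeqSizePow? p) + 1                ≡⟨ cardB-suc m p ⟨
  cardB (suc m) p                                                    ∎
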